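{- Let $k\ge3$, let $w$ be a nonnegative symmetric weight function satisfying the triangle inequality on a set of points containing $v_0,v_1,\dots,v_k$, and let $C=(v_0,v_1,\dots,v_k,v_0)$ be a $(k+1)$-cycle with weight $w(C)=\sum_{i=0}^{k}w(v_i,v_{(i+1)\bmod(k+1)})$. Define $\Delta_C=\sum_{i=1}^{k}w(v_0,v_i)$ and $w(T_C)=w(C)-\max_{0\le i\le k}w(v_i,v_{(i+1)\bmod(k+1)})$ (the weight of the spanning path obtained by deleting a heaviest edge of $C$). Then $\frac{2}{k}\Delta_C+\left(1-\frac{1}{k}\right)w(T_C)\leq\left(2-\frac{2l^2+k-1}{2kl}\right)w(C)$, where $l=\left\lceil\frac{\sqrt{2k-1}-1}{2}\right\rceil$.
   Context: In the paper $C$ is a tour of an optimal itinerary of unit-demand $k$-CVRP, with $v_0$ the depot and $v_1,\dots,v_k$ customers; the inequality is a statement about any such cycle in a semi-metric.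
   Formalization: The weight function w takes values in the nonnegative rationals instead of the nonnegative reals. -}

module Defs where

open import Data.Nat as ℕ using (ℕ; zero; suc; _∸_)
open import Data.Nat.DivMod using (_%_; m%n<n)
open import Data.Fin using (Fin; zero; suc; toℕ; fromℕ<)
open import Data.Integer using (+_)
open import Data.Rational using (ℚ; 0ℚ; _+_; _*_; _⊔_; _/_; 1/_; ≢-nonZero)
open import Data.Rational.Properties using (_≟_)
open import Data.Product using (_×_)
open import Relation.Binary.PropositionalEquality using (_≡_)
open import Relation.Nullary using (yes; no)

ι : ℕ → ℚ
ι n = + n / 1

-- total division on ℚ (x / 0 = 0 convention); only used with nonzero denominators
_÷_ : ℚ → ℚ → ℚ
p ÷ q with q ≟ 0ℚ
... | yes _ = 0ℚ
... | no q≢0 = p * 1/_ q {{≢-nonZero q≢0}}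

sumFin : ∀ {n} → (Fin n → ℚ) → ℚ
sumFin {zero} f = 0ℚ
sumFin {suc n} f = f zero + sumFin {n} (λ i → f (suc i))

maxFin : ∀ {n} → (Fin (suc n) → ℚ) → ℚ
maxFin {zero} f = f zero
maxFin {suc n} f = f zero ⊔ maxFin {n} (λ i → f (suc i))

csuc : ∀ {n} → Fin (suc n) → Fin (suc n)
csuc {n} i = fromℕ< (m%n<n (suc (toℕ i)) (suc n))

edgeW : ∀ {A : Set} {k} → (A → A → ℚ) → (Fin (suc k) → A) → Fin (suc k) → ℚ
edgeW w v i = w (v i) (v (csuc i))

weightC : ∀ {A : Set} {k} → (A → A → ℚ) → (Fin (suc k) → A) → ℚ
weightC w v = sumFin (edgeW w v)

deltaC : ∀ {A : Set} {k} → (A → A → ℚ) → (Fin (suc k) → A) → ℚ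
deltaC {k = k} w v = sumFin {k} (λ i → w (v zero) (v (suc i)))

weightT : ∀ {A : Set} {k} → (A → A → ℚ) → (Fin (suc k) → A) → ℚ
weightT w v = weightC w v Data.Rational.- maxFin (edgeW w v)

-- IsL k l  ⟺  l = ⌈(√(2k−1) − 1)/2⌉ , i.e. l − 1 < (√(2k−1) − 1)/2 ≤ l,
-- i.e. 2k−1 ≤ (2l+1)²  and (if l = m+1) (2m+1)² < 2k−1.
IsL : ℕ → ℕ → Set
IsL k l = (2 ℕ.* k ∸ 1 ℕ.≤ (2 ℕ.* l ℕ.+ 1) ℕ.* (2 ℕ.* l ℕ.+ 1))
        × (∀ m → l ≡ suc m → (2 ℕ.* m ℕ.+ 1) ℕ.* (2 ℕ.* m ℕ.+ 1) ℕ.< 2 ℕ.* k ∸ 1)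

-- Let dᵢ = w(v₀, vᵢ) and let M be the weight of a heaviest edge of C. The two arcs of C between
-- v₀ and vᵢ give dᵢ ≤ i·M, dᵢ ≤ (k + 1 − i)·M and 2dᵢ ≤ w(C). Bounding the t outermost chords on
-- either side by the first two and the k − 2t middle ones by the third gives
-- 2Δ_C ≤ 2t(t + 1)·M + (k − 2t)·w(C) whenever 2t ≤ k.
-- The choice of l says exactly that (l − 1)² + l² < k ≤ l² + (l + 1)². Adding the bounds for
-- t = l − 1 and t = l with the nonnegative weights l² + (l + 1)² − k and k − (l − 1)² − l², which
-- sum to 4l, makes the coefficient of M equal to 4l(k − 1). This cancels against the −(1 − 1/k)·M
-- hidden in w(T_C) = w(C) − M, and what remains is the claim multiplied by 4kl.

module Submission where

open import Defs
open import Data.Nat as ℕ using (ℕ; suc)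
open import Data.Fin using (Fin)
open import Data.Rational using (ℚ; 0ℚ; _+_; _*_; _-_; _≤_)
open import Relation.Binary.PropositionalEquality using (_≡_)

open import Data.Fin using (zero; suc; toℕ)
open import Data.Fin.Properties using (fromℕ<-cong; fromℕ<-toℕ; toℕ-fromℕ<; toℕ<n)
import Data.Integer as ℤ
import Data.Integer.Properties as ℤ
open import Data.Nat using (zero; s≤s; z<s; s<s; NonZero; _∸_; _<_)
open import Data.Nat.Coprimality as Coprime using ()
open import Data.Nat.DivMod using (_%_; _mod_; %-distribˡ-+; m%n%n≡m%n; m<n⇒m%n≡m; n%n≡0)
open import Data.Nat.Properties as ℕ
  using (+-suc; +-identityʳ; m∸n+n≡m; m+[n∸m]≡n; m≤m+n; m≤n+m; m≤n+m∸n; n≤1+n; <⇒≤)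
open import Data.Nat.Tactic.RingSolver using () renaming (solve-∀ to ℕ-solve-∀)
open import Data.Product using (_,_)
open import Data.Rational using (1ℚ; -_; _/_; 1/_; mkℚ; Positive; nonNegative; ≢-nonZero)
open import Data.Rational.Properties as ℚ
  using (+-*-commutativeRing; _≟_; normalize-coprime; normalize-pos; normalize-nonNeg; module ≤-Reasoning)
open import Level using (0ℓ)
open import Relation.Binary.PropositionalEquality
  using (_≢_; refl; sym; trans; cong; cong₂; subst; subst₂; module ≡-Reasoning)
open import Relation.Nullary using (yes; no; contradiction)
open import Relation.Nullary.Decidable using (dec⇒maybe)
open import Tactic.RingSolver using (solve-∀)
import Tactic.RingSolver.Core.AlmostCommutativeRing as ACR

ℚ-ring : ACR.AlmostCommutativeRing 0ℓ 0ℓ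
ℚ-ring = ACR.fromCommutativeRing +-*-commutativeRing (λ q → dec⇒maybe (0ℚ ≟ q))

ι-mkℚ : ∀ n → ι n ≡ mkℚ (ℤ.+ n) 0 (Coprime.sym (Coprime.1-coprimeTo n))
ι-mkℚ n = normalize-coprime (Coprime.sym (Coprime.1-coprimeTo n))

ι-+ : ∀ m n → ι (m ℕ.+ n) ≡ ι m + ι n
ι-+ m n rewrite ι-mkℚ m | ι-mkℚ n =
  cong (_/ 1) (sym (cong₂ ℤ._+_ (ℤ.*-identityʳ (ℤ.+ m)) (ℤ.*-identityʳ (ℤ.+ n))))

ι-* : ∀ m n → ι (m ℕ.* n) ≡ ι m * ι n
ι-* m n rewrite ι-mkℚ m | ι-mkℚ n = cong (_/ 1) (ℤ.pos-* m n)

ι-*-* : ∀ a b c → ι (a ℕ.* b ℕ.* c) ≡ ι a * ι b * ι c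
ι-*-* a b c = trans (ι-* (a ℕ.* b) c) (cong (_* ι c) (ι-* a b))

ι-suc : ∀ n → ι (suc n) ≡ 1ℚ + ι n
ι-suc = ι-+ 1

ι-∸ : ∀ {m n} → n ℕ.≤ m → ι (m ∸ n) ≡ ι m - ι n
ι-∸ {m} {n} n≤m = begin
  ι (m ∸ n)                ≡⟨ add-sub (ι (m ∸ n)) (ι n) ⟩
  (ι (m ∸ n) + ι n) - ι n  ≡⟨ cong (_- ι n) (sym (ι-+ (m ∸ n) n)) ⟩
  ι (m ∸ n ℕ.+ n) - ι n    ≡⟨ cong (λ x → ι x - ι n) (m∸n+n≡m n≤m) ⟩
  ι m - ι n                ∎
  where
  open ≡-Reasoning
  add-sub : ∀ x y → x ≡ (x + y) - y
  add-sub = solve-∀ ℚ-ring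

ι-nonNeg : ∀ n → 0ℚ ≤ ι n
ι-nonNeg n = ℚ.nonNegative⁻¹ (ι n) {{normalize-nonNeg n 1}}

ι-pos : ∀ n .{{_ : NonZero n}} → Positive (ι n)
ι-pos (suc n) = normalize-pos (suc n) 1

ι≢0 : ∀ n .{{_ : NonZero n}} → ι n ≢ 0ℚ
ι≢0 n ιn≡0 = ℚ.<-irrefl (sym ιn≡0) (ℚ.positive⁻¹ (ι n) {{ι-pos n}})

ι-mono-≤ : ∀ {m n} → m ℕ.≤ n → ι m ≤ ι n
ι-mono-≤ {m} {n} m≤n = begin
  ι m                   ≡⟨ sym (ℚ.+-identityʳ (ι m)) ⟩
  ι m + 0ℚ              ≤⟨ ℚ.+-monoʳ-≤ (ι m) (ι-nonNeg (n ∸ m)) ⟩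
  ι m + ι (n ∸ m)       ≡⟨ sym (ι-+ m (n ∸ m)) ⟩
  ι (m ℕ.+ (n ∸ m))     ≡⟨ cong ι (m+[n∸m]≡n m≤n) ⟩
  ι n                   ∎
  where open ≤-Reasoning

q*[p÷q]≡p : ∀ p {q} → q ≢ 0ℚ → q * (p ÷ q) ≡ p
q*[p÷q]≡p p {q} q≢0 with q ≟ 0ℚ
... | yes q≡0 = contradiction q≡0 q≢0
... | no q≢0′ = begin
  q * (p * 1/q)   ≡⟨ swap q p 1/q ⟩
  p * (q * 1/q)   ≡⟨ cong (p *_) (ℚ.*-inverseʳ q {{≢-nonZero q≢0′}}) ⟩
  p * 1ℚ          ≡⟨ ℚ.*-identityʳ p ⟩
  p               ∎
  where
  open ≡-Reasoning
  1/q = (1/ q) {{≢-nonZero q≢0′}}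
  swap : ∀ x y z → x * (y * z) ≡ y * (x * z)
  swap = solve-∀ ℚ-ring

p≤q⇒0≤q-p : ∀ {p q} → p ≤ q → 0ℚ ≤ q - p
p≤q⇒0≤q-p {p} {q} p≤q = begin
  0ℚ      ≡⟨ sym (ℚ.+-inverseʳ p) ⟩
  p - p   ≤⟨ ℚ.+-monoˡ-≤ (- p) p≤q ⟩
  q - p   ∎
  where open ≤-Reasoning

weighted-sum-mono-≤ : ∀ {p q a b c d} → 0ℚ ≤ p → 0ℚ ≤ q → a ≤ b → c ≤ d →
                      p * a + q * c ≤ p * b + q * d
weighted-sum-mono-≤ {p} {q} 0≤p 0≤q a≤b c≤d =
  ℚ.+-mono-≤ (ℚ.*-monoˡ-≤-nonNeg p {{nonNegative 0≤p}} a≤b)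
             (ℚ.*-monoˡ-≤-nonNeg q {{nonNegative 0≤q}} c≤d)

f≤maxFin : ∀ {n} (f : Fin (suc n) → ℚ) i → f i ≤ maxFin f
f≤maxFin {zero} f zero = ℚ.≤-refl
f≤maxFin {suc n}  f zero = ℚ.p≤p⊔q _ _
f≤maxFin {suc n}  f (suc i) = ℚ.≤-trans (f≤maxFin (λ j → f (suc j)) i) (ℚ.p≤q⊔p (f zero) _)

sumFrom : (ℕ → ℚ) → ℕ → ℕ → ℚ
sumFrom f a zero  = 0ℚ
sumFrom f a (suc n) = f a + sumFrom f (suc a) n

sumFin≡sumFrom : ∀ {n} (f : Fin n → ℚ) (g : ℕ → ℚ) a →
                 (∀ i → f i ≡ g (a ℕ.+ toℕ i)) → sumFin f ≡ sumFrom g a n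
sumFin≡sumFrom {zero} f g a f≗g = refl
sumFin≡sumFrom {suc n}  f g a f≗g =
  cong₂ _+_ (trans (f≗g zero) (cong g (+-identityʳ a)))
            (sumFin≡sumFrom (λ i → f (suc i)) g (suc a)
              (λ i → trans (f≗g (suc i)) (cong g (+-suc a (toℕ i)))))

sumFrom-++ : ∀ f a m n → sumFrom f a (m ℕ.+ n) ≡ sumFrom f a m + sumFrom f (a ℕ.+ m) n
sumFrom-++ f a zero n =
  trans (cong (λ b → sumFrom f b n) (sym (+-identityʳ a))) (sym (ℚ.+-identityˡ _))
sumFrom-++ f a (suc m) n = begin
  f a + sumFrom f (suc a) (m ℕ.+ n)
    ≡⟨ cong (f a +_) (sumFrom-++ f (suc a) m n) ⟩
  f a + (sumFrom f (suc a) m + sumFrom f (suc a ℕ.+ m) n)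
    ≡⟨ sym (ℚ.+-assoc (f a) _ _) ⟩
  (f a + sumFrom f (suc a) m) + sumFrom f (suc a ℕ.+ m) n
    ≡⟨ cong (λ b → f a + sumFrom f (suc a) m + sumFrom f b n) (sym (+-suc a m)) ⟩
  (f a + sumFrom f (suc a) m) + sumFrom f (a ℕ.+ suc m) n
    ∎
  where open ≡-Reasoning

sumFrom-snoc : ∀ f a n → sumFrom f a (suc n) ≡ sumFrom f a n + f (a ℕ.+ n)
sumFrom-snoc f a n = begin
  sumFrom f a (suc n)                ≡⟨ cong (sumFrom f a) (ℕ.+-comm 1 n) ⟩
  sumFrom f a (n ℕ.+ 1)              ≡⟨ sumFrom-++ f a n 1 ⟩
  sumFrom f a n + (f (a ℕ.+ n) + 0ℚ) ≡⟨ cong (sumFrom f a n +_) (ℚ.+-identityʳ _) ⟩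
  sumFrom f a n + f (a ℕ.+ n)        ∎
  where open ≡-Reasoning

*-sumFrom : ∀ c f a n → c * sumFrom f a n ≡ sumFrom (λ i → c * f i) a n
*-sumFrom c f a zero  = ℚ.*-zeroʳ c
*-sumFrom c f a (suc n) =
  trans (ℚ.*-distribˡ-+ c (f a) _) (cong (c * f a +_) (*-sumFrom c f (suc a) n))

sumFrom-bound : ∀ f a n {c} → (∀ j → j < n → f (a ℕ.+ j) ≤ c) → sumFrom f a n ≤ ι n * c
sumFrom-bound f a zero  {c} _   = ℚ.≤-reflexive (sym (ℚ.*-zeroˡ c))
sumFrom-bound f a (suc n) {c} f≤c = begin
  f a + sumFrom f (suc a) n   ≤⟨ ℚ.+-mono-≤ head≤c (sumFrom-bound f (suc a) n tail≤c) ⟩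
  c + ι n * c                 ≡⟨ one-more c (ι n) ⟩
  (1ℚ + ι n) * c              ≡⟨ cong (_* c) (sym (ι-suc n)) ⟩
  ι (suc n) * c               ∎
  where
  open ≤-Reasoning
  head≤c : f a ≤ c
  head≤c = subst (_≤ c) (cong f (+-identityʳ a)) (f≤c 0 z<s)
  tail≤c : ∀ j → j < n → f (suc a ℕ.+ j) ≤ c
  tail≤c j j<n = subst (_≤ c) (cong f (+-suc a j)) (f≤c (suc j) (s<s j<n))
  one-more : ∀ x y → x + y * x ≡ (1ℚ + y) * x
  one-more = solve-∀ ℚ-ring

path-triangle : ∀ {A : Set} (w : A → A → ℚ) → (∀ x y z → w x z ≤ w x y + w y z) →
                (u : ℕ → A) → ∀ a n {b} → a ℕ.+ suc n ≡ b →
                w (u a) (u b) ≤ sumFrom (λ j → w (u j) (u (suc j))) a (suc n)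
path-triangle w w-tri u a zero refl =
  ℚ.≤-reflexive (trans (cong (λ b → w (u a) (u b)) (ℕ.+-comm a 1)) (sym (ℚ.+-identityʳ _)))
path-triangle w w-tri u a (suc n) {b} a+n+2≡b =
  ℚ.≤-trans (w-tri (u a) (u (suc a)) (u b))
    (ℚ.+-monoʳ-≤ (w (u a) (u (suc a)))
      (path-triangle w w-tri u (suc a) n (trans (sym (+-suc a (suc n))) a+n+2≡b)))

-- 4 ((s + 1) + ⋯ + (s + t)): the t outermost pairs of chords of a window starting at position s + 1.
windowCoeff : ℕ → ℕ → ℚ
windowCoeff t s = ι 2 * ι t * (1ℚ + ι t + ι 2 * ι s)

windowCoeff-zero : ∀ s → windowCoeff 0 s ≡ 0ℚ
windowCoeff-zero s = vanish (ι s)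
  where
  vanish : ∀ S → ι 2 * ι 0 * (1ℚ + ι 0 + ι 2 * S) ≡ 0ℚ
  vanish = solve-∀ ℚ-ring

windowCoeff-suc : ∀ t s → windowCoeff (suc t) s ≡ windowCoeff t (suc s) + ι 4 * ι (suc s)
windowCoeff-suc t s = begin
  ι 2 * ι (suc t) * (1ℚ + ι (suc t) + ι 2 * ι s)
    ≡⟨ cong (λ T → ι 2 * T * (1ℚ + T + ι 2 * ι s)) (ι-suc t) ⟩
  ι 2 * (1ℚ + ι t) * (1ℚ + (1ℚ + ι t) + ι 2 * ι s)
    ≡⟨ shift (ι t) (ι s) ⟩
  ι 2 * ι t * (1ℚ + ι t + ι 2 * (1ℚ + ι s)) + ι 4 * (1ℚ + ι s)
    ≡⟨ cong (λ S → ι 2 * ι t * (1ℚ + ι t + ι 2 * S) + ι 4 * S) (sym (ι-suc s)) ⟩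
  ι 2 * ι t * (1ℚ + ι t + ι 2 * ι (suc s)) + ι 4 * ι (suc s)
    ∎
  where
  open ≡-Reasoning
  shift : ∀ T S → ι 2 * (1ℚ + T) * (1ℚ + (1ℚ + T) + ι 2 * S)
                    ≡ ι 2 * T * (1ℚ + T + ι 2 * (1ℚ + S)) + ι 4 * (1ℚ + S)
  shift = solve-∀ ℚ-ring

windowCoeff-outermost : ∀ t → windowCoeff t 0 ≡ ι 2 * ι t * (1ℚ + ι t)
windowCoeff-outermost t = simplify (ι t)
  where
  simplify : ∀ T → ι 2 * T * (1ℚ + T + ι 2 * ι 0) ≡ ι 2 * T * (1ℚ + T)
  simplify = solve-∀ ℚ-ring

pairingBound : ℚ → ℚ → ℚ → ℚ → ℚ
pairingBound K T M W = ι 2 * T * (1ℚ + T) * M + (K - ι 2 * T) * W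

module ChordSum (k : ℕ) (d : ℕ → ℚ) (M W : ℚ)
  (d≤prefix : ∀ i → d (suc i) ≤ ι (suc i) * M)
  (d≤suffix : ∀ i j → suc (i ℕ.+ j) ≡ k → d (suc i) ≤ ι (suc j) * M)
  (2d≤W : ∀ i → i < k → ι 2 * d (suc i) ≤ W)
  where

  middle-bound : ∀ s r → s ℕ.+ s ℕ.+ r ≡ k → ι 2 * sumFrom d (suc s) r ≤ ι r * W
  middle-bound s r s+s+r≡k = begin
    ι 2 * sumFrom d (suc s) r            ≡⟨ *-sumFrom (ι 2) d (suc s) r ⟩
    sumFrom (λ i → ι 2 * d i) (suc s) r  ≤⟨ sumFrom-bound _ (suc s) r (λ j j<r → 2d≤W (s ℕ.+ j) (inside j<r)) ⟩
    ι r * W                              ∎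
    where
    open ≤-Reasoning
    inside : ∀ {j} → j < r → s ℕ.+ j < k
    inside j<r = ℕ.≤-trans (ℕ.+-monoʳ-< s j<r)
                   (ℕ.≤-trans (ℕ.+-monoˡ-≤ r (m≤m+n s s)) (ℕ.≤-reflexive s+s+r≡k))

  -- The window holds the chords at positions s + 1, …, k − s; its t outermost chords on either
  -- side are bounded through M, the r middle ones through W.
  window-bound : ∀ t s r → s ℕ.+ s ℕ.+ (t ℕ.+ t ℕ.+ r) ≡ k →
                 ι 2 * sumFrom d (suc s) (t ℕ.+ t ℕ.+ r) ≤ windowCoeff t s * M + ι r * W
  window-bound zero s r s+s+r≡k =
    ℚ.≤-trans (middle-bound s r s+s+r≡k) (ℚ.≤-reflexive (sym no-pairs))
    where
    no-pairs : windowCoeff 0 s * M + ι r * W ≡ ι r * W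
    no-pairs = trans (cong (λ C → C * M + ι r * W) (windowCoeff-zero s))
                     (trans (cong (_+ ι r * W) (ℚ.*-zeroˡ M)) (ℚ.+-identityˡ _))
  window-bound (suc t) s r e = begin
    ι 2 * sumFrom d (suc s) (suc t ℕ.+ suc t ℕ.+ r)
      ≡⟨ cong (λ m → ι 2 * sumFrom d (suc s) m) length ⟩
    ι 2 * (first + sumFrom d (suc (suc s)) (suc n))
      ≡⟨ cong (λ x → ι 2 * (first + x)) (sumFrom-snoc d (suc (suc s)) n) ⟩
    ι 2 * (first + (inner + last))
      ≡⟨ split-ends first inner last ⟩
    ι 2 * inner + ι 2 * (first + last)
      ≤⟨ ℚ.+-mono-≤ (window-bound t (suc s) r inner-fits) ends ⟩
    (windowCoeff t (suc s) * M + ι r * W) + ι 2 * (ι (suc s) * M + ι (suc s) * M)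
      ≡⟨ collect (windowCoeff t (suc s)) (ι (suc s)) M (ι r * W) ⟩
    (windowCoeff t (suc s) + ι 4 * ι (suc s)) * M + ι r * W
      ≡⟨ cong (λ C → C * M + ι r * W) (sym (windowCoeff-suc t s)) ⟩
    windowCoeff (suc t) s * M + ι r * W
      ∎
    where
    open ≤-Reasoning
    n = t ℕ.+ t ℕ.+ r
    first = d (suc s)
    inner = sumFrom d (suc (suc s)) n
    last = d (suc (suc (s ℕ.+ n)))
    length : suc t ℕ.+ suc t ℕ.+ r ≡ suc (suc n)
    length = cong (λ m → suc (m ℕ.+ r)) (+-suc t t)
    e′ : s ℕ.+ s ℕ.+ suc (suc n) ≡ k
    e′ = trans (cong (s ℕ.+ s ℕ.+_) (sym length)) e
    inner-shift : ∀ s n → suc s ℕ.+ suc s ℕ.+ n ≡ s ℕ.+ s ℕ.+ suc (suc n)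
    inner-shift = ℕ-solve-∀
    last-shift : ∀ s n → suc (suc (s ℕ.+ n) ℕ.+ s) ≡ s ℕ.+ s ℕ.+ suc (suc n)
    last-shift = ℕ-solve-∀
    inner-fits : suc s ℕ.+ suc s ℕ.+ n ≡ k
    inner-fits = trans (inner-shift s n) e′
    ends : ι 2 * (first + last) ≤ ι 2 * (ι (suc s) * M + ι (suc s) * M)
    ends = ℚ.*-monoˡ-≤-nonNeg (ι 2) {{nonNegative (ι-nonNeg 2)}}
             (ℚ.+-mono-≤ (d≤prefix s) (d≤suffix (suc (s ℕ.+ n)) s (trans (last-shift s n) e′)))
    split-ends : ∀ a R b → ι 2 * (a + (R + b)) ≡ ι 2 * R + ι 2 * (a + b)
    split-ends = solve-∀ ℚ-ring
    collect : ∀ C S M Y → (C * M + Y) + ι 2 * (S * M + S * M) ≡ (C + ι 4 * S) * M + Y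
    collect = solve-∀ ℚ-ring

  pairing : ∀ t → t ℕ.+ t ℕ.≤ k → ι 2 * sumFrom d 1 k ≤ pairingBound (ι k) (ι t) M W
  pairing t 2t≤k = subst₂ _≤_ (cong (λ m → ι 2 * sumFrom d 1 m) 2t+r≡k) coefficients
                     (window-bound t 0 r 2t+r≡k)
    where
    r = k ∸ (t ℕ.+ t)
    2t+r≡k : t ℕ.+ t ℕ.+ r ≡ k
    2t+r≡k = m+[n∸m]≡n 2t≤k
    ι-r : ι r ≡ ι k - ι 2 * ι t
    ι-r = trans (ι-∸ 2t≤k) (cong (λ x → ι k - x) (trans (ι-+ t t) (double (ι t))))
      where
      double : ∀ x → x + x ≡ ι 2 * x
      double = solve-∀ ℚ-ring
    coefficients : windowCoeff t 0 * M + ι r * W ≡ pairingBound (ι k) (ι t) M W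
    coefficients = cong₂ (λ C R → C * M + R * W) (windowCoeff-outermost t) ι-r

suc-%-% : ∀ j n .{{_ : NonZero n}} → suc (j % n) % n ≡ suc j % n
suc-%-% j n = begin
  (1 ℕ.+ j % n) % n          ≡⟨ %-distribˡ-+ 1 (j % n) n ⟩
  (1 % n ℕ.+ j % n % n) % n  ≡⟨ cong (λ x → (1 % n ℕ.+ x) % n) (m%n%n≡m%n j n) ⟩
  (1 % n ℕ.+ j % n) % n      ≡⟨ sym (%-distribˡ-+ 1 j n) ⟩
  (1 ℕ.+ j) % n              ∎
  where open ≡-Reasoning

module Cycle {A : Set} (w : A → A → ℚ) (w-sym : ∀ x y → w x y ≡ w y x)
  (w-tri : ∀ x y z → w x z ≤ w x y + w y z) {k : ℕ} (v : Fin (suc k) → A)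
  where

  u : ℕ → A
  u n = v (n mod suc k)

  edge chord : ℕ → ℚ
  edge j  = w (u j) (u (suc j))
  chord i = w (u 0) (u i)

  maxEdge : ℚ
  maxEdge = maxFin (edgeW w v)

  u-cong : ∀ m n → m % suc k ≡ n % suc k → u m ≡ u n
  u-cong m n m≡n = cong v (fromℕ<-cong _ _ m≡n _ _)

  v≡u : ∀ i → v i ≡ u (toℕ i)
  v≡u i = cong v (sym (trans (fromℕ<-cong _ _ (m<n⇒m%n≡m (toℕ<n i)) _ (toℕ<n i)) (fromℕ<-toℕ i _)))

  u-periodic : u (suc k) ≡ u 0
  u-periodic = u-cong (suc k) 0 (n%n≡0 (suc k))

  edge≤maxEdge : ∀ j → edge j ≤ maxEdge
  edge≤maxEdge j = subst (_≤ maxEdge) (sym edge≡edgeW) (f≤maxFin (edgeW w v) (j mod suc k))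
    where
    edge≡edgeW : edge j ≡ edgeW w v (j mod suc k)
    edge≡edgeW = cong (w (u j)) (u-cong (suc j) (suc (toℕ (j mod suc k))) (trans (sym (suc-%-% j (suc k)))
                   (cong (λ x → suc x % suc k) (sym (toℕ-fromℕ< _)))))

  weight≡sumFrom : weightC w v ≡ sumFrom edge 0 (suc k)
  weight≡sumFrom = sumFin≡sumFrom (edgeW w v) edge 0 (λ i → cong (λ x → w x (v (csuc i))) (v≡u i))

  delta≡sumFrom : deltaC w v ≡ sumFrom chord 1 k
  delta≡sumFrom = sumFin≡sumFrom _ chord 1 (λ i → cong₂ w (v≡u zero) (v≡u (suc i)))

  chord≤prefix-path : ∀ i → chord (suc i) ≤ sumFrom edge 0 (suc i)
  chord≤prefix-path i = path-triangle w w-tri u 0 i refl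

  chord≤suffix-path : ∀ i j → suc (i ℕ.+ j) ≡ k → chord (suc i) ≤ sumFrom edge (suc i) (suc j)
  chord≤suffix-path i j i+j+1≡k =
    subst (_≤ sumFrom edge (suc i) (suc j)) (trans (cong (w (u (suc i))) u-periodic) (w-sym _ _))
      (path-triangle w w-tri u (suc i) j (cong suc (trans (+-suc i j) i+j+1≡k)))

  chord≤prefix : ∀ i → chord (suc i) ≤ ι (suc i) * maxEdge
  chord≤prefix i = ℚ.≤-trans (chord≤prefix-path i)
                     (sumFrom-bound edge 0 (suc i) (λ j _ → edge≤maxEdge j))

  chord≤suffix : ∀ i j → suc (i ℕ.+ j) ≡ k → chord (suc i) ≤ ι (suc j) * maxEdge
  chord≤suffix i j i+j+1≡k = ℚ.≤-trans (chord≤suffix-path i j i+j+1≡k)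
                               (sumFrom-bound edge (suc i) (suc j) (λ j′ _ → edge≤maxEdge _))

  2chord≤weight : ∀ i → i < k → ι 2 * chord (suc i) ≤ weightC w v
  2chord≤weight i i<k = begin
    ι 2 * chord (suc i)                                     ≡⟨ double (chord (suc i)) ⟩
    chord (suc i) + chord (suc i)                           ≤⟨ ℚ.+-mono-≤ (chord≤prefix-path i) (chord≤suffix-path i j i+j+1≡k) ⟩
    sumFrom edge 0 (suc i) + sumFrom edge (suc i) (suc j)   ≡⟨ sym (sumFrom-++ edge 0 (suc i) (suc j)) ⟩
    sumFrom edge 0 (suc i ℕ.+ suc j)                        ≡⟨ cong (λ n → sumFrom edge 0 (suc n)) (trans (+-suc i j) i+j+1≡k) ⟩
    sumFrom edge 0 (suc k)                                  ≡⟨ sym weight≡sumFrom ⟩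
    weightC w v                                             ∎
    where
    open ≤-Reasoning
    j = k ∸ suc i
    i+j+1≡k : suc (i ℕ.+ j) ≡ k
    i+j+1≡k = m+[n∸m]≡n i<k
    double : ∀ x → ι 2 * x ≡ x + x
    double = solve-∀ ℚ-ring

  open ChordSum k chord maxEdge (weightC w v) chord≤prefix chord≤suffix 2chord≤weight

  delta-pairing : ∀ t → t ℕ.+ t ℕ.≤ k → ι 2 * deltaC w v ≤ pairingBound (ι k) (ι t) maxEdge (weightC w v)
  delta-pairing t 2t≤k =
    subst (λ D → ι 2 * D ≤ pairingBound (ι k) (ι t) maxEdge (weightC w v)) (sym delta≡sumFrom) (pairing t 2t≤k)

centredSquare : ℕ → ℕ
centredSquare n = n ℕ.* n ℕ.+ suc n ℕ.* suc n

odd-square : ∀ n → suc ((2 ℕ.* n ℕ.+ 1) ℕ.* (2 ℕ.* n ℕ.+ 1)) ≡ 2 ℕ.* (n ℕ.* n ℕ.+ suc n ℕ.* suc n)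
odd-square = ℕ-solve-∀

isL⇒centredSquare<k : ∀ k m → IsL k (suc m) → centredSquare m < k
isL⇒centredSquare<k k m (_ , lower) =
  ℕ.*-cancelˡ-< 2 _ _ (ℕ.pred-cancel-< (subst (_< 2 ℕ.* k ∸ 1) (cong ℕ.pred (odd-square m)) (lower m refl)))

isL⇒k≤centredSquare : ∀ k l → IsL k l → k ℕ.≤ centredSquare l
isL⇒k≤centredSquare k l (upper , _) =
  ℕ.*-cancelˡ-≤ 2 (ℕ.≤-trans (m≤n+m∸n (2 ℕ.* k) 1) (subst (suc (2 ℕ.* k ∸ 1) ℕ.≤_) (odd-square l) (s≤s upper)))

2[1+n]≤1+centredSquare : ∀ n → suc n ℕ.+ suc n ℕ.≤ suc (centredSquare n)
2[1+n]≤1+centredSquare n = subst (suc n ℕ.+ suc n ℕ.≤_) (sym (split n)) (m≤m+n _ _)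
  where
  split : ∀ n → suc (n ℕ.* n ℕ.+ suc n ℕ.* suc n) ≡ suc n ℕ.+ suc n ℕ.+ (n ℕ.* n ℕ.+ n ℕ.* n)
  split = ℕ-solve-∀

ι-centredSquare : ∀ n → ι (centredSquare n) ≡ ι n * ι n + (1ℚ + ι n) * (1ℚ + ι n)
ι-centredSquare n = trans (ι-+ (n ℕ.* n) (suc n ℕ.* suc n))
  (cong₂ _+_ (ι-* n n) (trans (ι-* (suc n) (suc n)) (cong₂ _*_ (ι-suc n) (ι-suc n))))

interpolate : ∀ {K T L D M W : ℚ} → L ≡ 1ℚ + T →
              T * T + (1ℚ + T) * (1ℚ + T) ≤ K → K ≤ L * L + (1ℚ + L) * (1ℚ + L) →
              ι 2 * D ≤ pairingBound K T M W → ι 2 * D ≤ pairingBound K L M W →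
              ι 4 * L * (ι 2 * D + (K - 1ℚ) * (W - M))
                ≤ (ι 8 * K * L - ι 2 * (ι 2 * L * L + K - 1ℚ)) * W
interpolate {K} {T} {D = D} {M} {W} refl lower upper bound-T bound-L = begin
  ι 4 * L * (ι 2 * D + (K - 1ℚ) * (W - M))
    ≡⟨ weights-sum T K (ι 2 * D) ((K - 1ℚ) * (W - M)) ⟩
  (P * (ι 2 * D) + Q * (ι 2 * D)) + E
    ≤⟨ ℚ.+-monoˡ-≤ E (weighted-sum-mono-≤ (p≤q⇒0≤q-p upper) (p≤q⇒0≤q-p lower) bound-T bound-L) ⟩
  (P * pairingBound K T M W + Q * pairingBound K L M W) + E
    ≡⟨ M-cancels T K M W ⟩
  (ι 8 * K * L - ι 2 * (ι 2 * L * L + K - 1ℚ)) * W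
    ∎
  where
  open ≤-Reasoning
  -- The weights P ≥ 0 and Q ≥ 0 sum to 4L and make the M-terms cancel against those of E.
  L = 1ℚ + T
  P = L * L + (1ℚ + L) * (1ℚ + L) - K
  Q = K - (T * T + L * L)
  E = ι 4 * L * ((K - 1ℚ) * (W - M))
  weights-sum : ∀ T K x y → let L = 1ℚ + T in
                ι 4 * L * (x + y)
                  ≡ ((L * L + (1ℚ + L) * (1ℚ + L) - K) * x + (K - (T * T + L * L)) * x) + ι 4 * L * y
  weights-sum = solve-∀ ℚ-ring
  M-cancels : ∀ T K M W → let L = 1ℚ + T in
              ((L * L + (1ℚ + L) * (1ℚ + L) - K) * (ι 2 * T * (1ℚ + T) * M + (K - ι 2 * T) * W)
                + (K - (T * T + L * L)) * (ι 2 * L * (1ℚ + L) * M + (K - ι 2 * L) * W))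
                + ι 4 * L * ((K - 1ℚ) * (W - M))
                ≡ (ι 8 * K * L - ι 2 * (ι 2 * L * L + K - 1ℚ)) * W
  M-cancels = solve-∀ ℚ-ring

clear-denominators : ∀ k l .{{_ : NonZero k}} .{{_ : NonZero l}} {D M W : ℚ} →
                     ι 4 * ι l * (ι 2 * D + (ι k - 1ℚ) * (W - M))
                       ≤ (ι 8 * ι k * ι l - ι 2 * (ι 2 * ι l * ι l + ι k - 1ℚ)) * W →
                     (ι 2 ÷ ι k) * D + (ι 1 - ι 1 ÷ ι k) * (W - M)
                       ≤ (ι 2 - ι (2 ℕ.* l ℕ.* l ℕ.+ k ∸ 1) ÷ ι (2 ℕ.* k ℕ.* l)) * W
clear-denominators k l {D} {M} {W} scaled =
  ℚ.*-cancelˡ-≤-pos c {{c-pos}} (subst₂ _≤_ (sym scaled-lhs) (sym scaled-rhs) scaled)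
  where
  open ≡-Reasoning
  K = ι k
  L = ι l
  N = 2 ℕ.* l ℕ.* l ℕ.+ k ∸ 1
  c = ι 4 * K * L
  c-pos : Positive c
  c-pos = ℚ.pos*pos⇒pos (ι 4 * K) {{ℚ.pos*pos⇒pos (ι 4) {{ι-pos 4}} K {{ι-pos k}}}} L {{ι-pos l}}
  expand-lhs : ∀ K L a b D X → ι 4 * K * L * (a * D + (ι 1 - b) * X) ≡ ι 4 * L * (K * a * D + (K - K * b) * X)
  expand-lhs = solve-∀ ℚ-ring
  expand-rhs : ∀ K L e W → ι 4 * K * L * ((ι 2 - e) * W) ≡ (ι 8 * K * L - ι 2 * (ι 2 * K * L * e)) * W
  expand-rhs = solve-∀ ℚ-ring
  scaled-lhs : c * ((ι 2 ÷ K) * D + (ι 1 - ι 1 ÷ K) * (W - M)) ≡ ι 4 * L * (ι 2 * D + (K - 1ℚ) * (W - M))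
  scaled-lhs = trans (expand-lhs K L (ι 2 ÷ K) (ι 1 ÷ K) D (W - M))
    (cong₂ (λ a b → ι 4 * L * (a * D + (K - b) * (W - M))) (q*[p÷q]≡p (ι 2) (ι≢0 k)) (q*[p÷q]≡p (ι 1) (ι≢0 k)))
  ι-N : ι N ≡ ι 2 * L * L + K - 1ℚ
  ι-N = trans (ι-∸ (ℕ.≤-trans (ℕ.>-nonZero⁻¹ k) (m≤n+m k (2 ℕ.* l ℕ.* l))))
              (cong (_- 1ℚ) (trans (ι-+ (2 ℕ.* l ℕ.* l) k) (cong (_+ K) (ι-*-* 2 l l))))
  2KL*[N÷2kl]≡N : ι 2 * K * L * (ι N ÷ ι (2 ℕ.* k ℕ.* l)) ≡ ι 2 * L * L + K - 1ℚ
  2KL*[N÷2kl]≡N = begin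
    ι 2 * K * L * (ι N ÷ ι (2 ℕ.* k ℕ.* l))        ≡⟨ cong (_* (ι N ÷ ι (2 ℕ.* k ℕ.* l))) (sym (ι-*-* 2 k l)) ⟩
    ι (2 ℕ.* k ℕ.* l) * (ι N ÷ ι (2 ℕ.* k ℕ.* l))  ≡⟨ q*[p÷q]≡p (ι N) (ι≢0 (2 ℕ.* k ℕ.* l) {{ℕ.m*n≢0 (2 ℕ.* k) l {{ℕ.m*n≢0 2 k}}}}) ⟩
    ι N                                            ≡⟨ ι-N ⟩
    ι 2 * L * L + K - 1ℚ                           ∎
  scaled-rhs : c * ((ι 2 - ι N ÷ ι (2 ℕ.* k ℕ.* l)) * W) ≡ (ι 8 * K * L - ι 2 * (ι 2 * L * L + K - 1ℚ)) * W
  scaled-rhs = trans (expand-rhs K L (ι N ÷ ι (2 ℕ.* k ℕ.* l)) W)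
                     (cong (λ x → (ι 8 * K * L - ι 2 * x) * W) 2KL*[N÷2kl]≡N)

lemma22 : (k : ℕ) → 3 ℕ.≤ k → (l : ℕ) → IsL k l →
          {A : Set} (w : A → A → ℚ) →
          (∀ x y → 0ℚ ≤ w x y) →
          (∀ x y → w x y ≡ w y x) →
          (∀ x y z → w x z ≤ w x y + w y z) →
          (v : Fin (suc k) → A) →
          (ι 2 ÷ ι k) * deltaC w v + (ι 1 - ι 1 ÷ ι k) * weightT w v
            ≤ (ι 2 - ι (2 ℕ.* l ℕ.* l ℕ.+ k ℕ.∸ 1) ÷ ι (2 ℕ.* k ℕ.* l)) * weightC w v
lemma22 _ (s≤s (s≤s (s≤s _))) zero (s≤s () , _) _ _ _ _ _
lemma22 k (s≤s _) (suc m) isL w _ w-sym w-tri v =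
  clear-denominators k (suc m)
    (interpolate {T = ι m} {D = deltaC w v} (ι-suc m) lower upper
      (delta-pairing m 2m≤k) (delta-pairing (suc m) 2l≤k))
  where
  open Cycle w w-sym w-tri v
  cs[m]<k = isL⇒centredSquare<k k m isL
  2l≤k : suc m ℕ.+ suc m ℕ.≤ k
  2l≤k = ℕ.≤-trans (2[1+n]≤1+centredSquare m) cs[m]<k
  2m≤k : m ℕ.+ m ℕ.≤ k
  2m≤k = ℕ.≤-trans (ℕ.+-mono-≤ (n≤1+n m) (n≤1+n m)) 2l≤k
  lower : ι m * ι m + (1ℚ + ι m) * (1ℚ + ι m) ≤ ι k
  lower = subst (_≤ ι k) (ι-centredSquare m) (ι-mono-≤ (<⇒≤ cs[m]<k))
  upper : ι k ≤ ι (suc m) * ι (suc m) + (1ℚ + ι (suc m)) * (1ℚ + ι (suc m))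
  upper = subst (ι k ≤_) (ι-centredSquare (suc m)) (ι-mono-≤ (isL⇒k≤centredSquare k (suc m) isL))
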